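{- Let $\mathbf H$ be a finite atomic connected hypergraph. For all constructs $S,T$ of $\mathbf H$: $S\le^{\mathbf H}T$ if and only if $\psi(T)\subseteq\psi(S)$.
   Context: A hypergraph $\mathbf{H}$ on a finite set $H$ is a set $\mathbf{H}\subseteq\mathcal{P}(H)\setminus\{\emptyset\}$ with $\bigcup\mathbf{H}=H$; atomic means $\{x\}\in\mathbf{H}$ for all $x\in H$. For $X\subseteq H$, $\mathbf{H}_X=\{Z\in\mathbf{H}: Z\subseteq X\}$. $\mathbf{H}$ is connected if there is no partition $H=X_1\cup X_2$ into non-empty disjoint sets with $\mathbf{H}=\mathbf{H}_{X_1}\cup\mathbf{H}_{X_2}$. $\mathbf{H},X\leadsto H_1,\dots,H_n$ means that $H_1,\dots,H_n$ are the connected components of $\mathbf{H}_{H\setminus X}$, and $\mathbf{H}_i:=\mathbf{H}_{H_i}$. Constructs of connected $\mathbf H$: for non-empty $Y\subseteq H$, if $Y=H$ the one-node tree $H$ is a construct; if $Y\ne H$, $\mathbf H,Y\leadsto H_1,\dots,H_n$ and $T_i$ are constructs of $\mathbf H_i$, then $Y(T_1,\dots,T_n)$ (root labelled $Y$, unordered subtrees $T_i$) is a construct. $\le^{\mathbf H}$: the smallest reflexive transitive relation on constructs such that (i) $Y(X(T_{11},\dots,T_{1m}),T_2,\dots,T_n)\le^{\mathbf H}(Y\cup X)(T_{11},\dots,T_{1m},T_2,\dots,T_n)$ whenever $\emptyset\ne Y\subsetneq H$, $\mathbf H,Y\leadsto K_1,\dots,K_n$, $\emptyset\neq X\subseteq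 K_1$, $\mathbf K_1,X\leadsto H_{11},\dots,H_{1m}$, $T_{1j}$ constructs of $\mathbf H_{1j}$, $T_i$ constructs of $\mathbf K_i$ ($i\ge2$); (ii) $Y(T_1,T_2,\dots,T_n)\le^{\mathbf H}Y(T_1',T_2,\dots,T_n)$ whenever $\mathbf H,Y\leadsto H_1,\dots,H_n$ and $T_1\le^{\mathbf H_1}T_1'$. For a node labelled $Y$ of a construct $T$, $\uparrow_T(Y)$ is the union of the labels of $Y$ and of all its descendants in $T$; $\psi(T)=\{\uparrow_T(Y):Y\text{ a node of }T\}$. -}

module Defs where

open import Data.Nat using (ℕ)
open import Data.Bool using (Bool; true; false)
open import Data.Fin using (Fin)
open import Data.Fin.Subset using (Subset; _∈_; _⊆_; _⊂_; _∪_; _∩_; _─_; ⁅_⁆; Nonempty; Empty) renaming (⊥ to ∅)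
open import Data.List using (List; []; _∷_; _++_)
open import Data.List.Relation.Unary.All using (All)
open import Data.List.Relation.Unary.Any using (Any)
open import Data.List.Relation.Unary.AllPairs using (AllPairs)
open import Data.List.Relation.Binary.Pointwise using (Pointwise)
open import Data.List.Relation.Binary.Permutation.Propositional using (_↭_)
open import Data.List.Membership.Propositional using () renaming (_∈_ to _∈ᴸ_)
open import Data.Product using (Σ; ∃; _×_; _,_)
open import Data.Sum using (_⊎_)
open import Relation.Nullary using (¬_)
open import Relation.Binary.PropositionalEquality using (_≡_)

-- Hypergraphs on subsets of the finite set Fin n.
-- A hypergraph is given by its set of hyperedges, as a decidable
-- (Boolean-valued) predicate on subsets of Fin n.

Edges : ℕ → Set
Edges n = Subset n → Bool

IsEdge : ∀ {n} → Edges n → Subset n → Set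
IsEdge E Z = E Z ≡ true

IsHypergraphOn : ∀ {n} → Edges n → Subset n → Set
IsHypergraphOn E H =
  (¬ IsEdge E ∅) ×
  (∀ Z → IsEdge E Z → Z ⊆ H) ×
  (∀ x → x ∈ H → ∃ λ Z → IsEdge E Z × x ∈ Z)

Atomic : ∀ {n} → Edges n → Subset n → Set
Atomic E H = ∀ x → x ∈ H → IsEdge E ⁅ x ⁆

-- 𝐇_C (edges of E contained in C), viewed as a hypergraph on C, is
-- connected: no partition C = X₁ ∪ X₂ into non-empty disjoint sets with
-- 𝐇_C = (𝐇_C)_{X₁} ∪ (𝐇_C)_{X₂}.
Connected : ∀ {n} → Edges n → Subset n → Set
Connected E C =
  ∀ X₁ X₂ → Nonempty X₁ → Nonempty X₂ → Empty (X₁ ∩ X₂) → X₁ ∪ X₂ ≡ C →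
  ¬ (∀ Z → IsEdge E Z → Z ⊆ C → Z ⊆ X₁ ⊎ Z ⊆ X₂)

-- Components E G Y Cs :  𝐇_G , Y ⇝ Cs, i.e. Cs (in some order) is the
-- list of connected components of 𝐇_{G ∖ Y}: a partition of the vertex
-- set ⋃ 𝐇_{G∖Y} into non-empty pairwise disjoint blocks, each
-- inducing a connected hypergraph, such that every edge of 𝐇_{G∖Y} lies
-- inside one block.
Components : ∀ {n} → Edges n → Subset n → Subset n → List (Subset n) → Set
Components E G Y Cs =
  All Nonempty Cs ×
  AllPairs (λ A B → Empty (A ∩ B)) Cs ×
  (∀ x → (Any (x ∈_) Cs → ∃ λ Z → IsEdge E Z × Z ⊆ (G ─ Y) × x ∈ Z)
       × ((∃ λ Z → IsEdge E Z × Z ⊆ (G ─ Y) × x ∈ Z) → Any (x ∈_) Cs)) ×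
  (∀ Z → IsEdge E Z → Z ⊆ (G ─ Y) → Any (Z ⊆_) Cs) ×
  All (Connected E) Cs

-- Rooted trees with subset labels and (a list of) children.
-- Children order is irrelevant for constructs; this is handled below by
-- permutations.

data Tree (n : ℕ) : Set where
  node : Subset n → List (Tree n) → Tree n

data IsConstruct {n} (E : Edges n) (G : Subset n) : Tree n → Set where
  leaf : ∀ {Y} → Nonempty Y → Y ≡ G → IsConstruct E G (node Y [])
  step : ∀ {Y Cs ts} → Nonempty Y → Y ⊂ G →
         Components E G Y Cs →
         Pointwise (λ C t → IsConstruct E C t) Cs ts →
         IsConstruct E G (node Y ts)

data Le {n} (E : Edges n) : Subset n → Tree n → Tree n → Set where
  le-refl  : ∀ {G T} → Le E G T T
  le-trans : ∀ {G S T U} → Le E G S T → Le E G T U → Le E G S U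
  le-merge : ∀ {G Y X K₁ Ks Hs t₁s t₂s ts us} →
    Nonempty Y → Y ⊂ G →
    Components E G Y (K₁ ∷ Ks) →
    Nonempty X → X ⊆ K₁ →
    Components E K₁ X Hs →
    Pointwise (λ C t → IsConstruct E C t) Hs t₁s →
    Pointwise (λ C t → IsConstruct E C t) Ks t₂s →
    ts ↭ (node X t₁s ∷ t₂s) →
    us ↭ (t₁s ++ t₂s) →
    Le E G (node Y ts) (node (Y ∪ X) us)
  le-sub : ∀ {G Y H₁ Hs t₁ t₁′ t₂s ts ts′} →
    Nonempty Y → Y ⊂ G →
    Components E G Y (H₁ ∷ Hs) →
    IsConstruct E H₁ t₁ →
    Pointwise (λ C t → IsConstruct E C t) Hs t₂s →
    Le E H₁ t₁ t₁′ →
    ts ↭ (t₁ ∷ t₂s) →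
    ts′ ↭ (t₁′ ∷ t₂s) →
    Le E G (node Y ts) (node Y ts′)

mutual
  up : ∀ {n} → Tree n → Subset n
  up (node Y ts) = Y ∪ upList ts

  upList : ∀ {n} → List (Tree n) → Subset n
  upList [] = ∅
  upList (t ∷ ts) = up t ∪ upList ts

data InPsi {n} (Z : Subset n) : Tree n → Set where
  here  : ∀ {Y ts} → Z ≡ up (node Y ts) → InPsi Z (node Y ts)
  there : ∀ {Y ts t} → t ∈ᴸ ts → InPsi Z t → InPsi Z (node Y ts)

_⊆ψ_ : ∀ {n} → Tree n → Tree n → Set
T ⊆ψ S = ∀ Z → InPsi Z T → InPsi Z S

-- (⇒) Both generating rules preserve the union ↑ of all labels and only delete
--     elements of ψ; induction on the derivation of S ≤ T.
-- (⇐) Induction on the number of nodes of S, for constructs of every 𝐇_G with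
--     G ⊆ H.  Let S = Y(ts), T = Y′(us) and ψ(T) ⊆ ψ(S).  Atomicity makes the
--     components of 𝐇_{G∖Y} cover G ∖ Y.
--     * If x ∈ Y′ ∖ Y, x lies in a component C whose subtree in S is X(t₁s).
--       Rule (i) gives S ≤ S′ = (Y ∪ X)(t₁s, ...), a smaller construct with
--       ψ(S) ⊆ ψ(S′) ∪ {C}; as C meets the root of T, C ∉ ψ(T), so S′ ≤ T.
--     * Otherwise Y′ ⊆ Y ⊆ Y′.  Connectivity makes the components of G ∖ Y
--       unique up to order, ψ(T) ⊆ ψ(S) restricts to each component, and the
--       subtrees are compared by induction and rule (ii).

module Submission where

open import Defs
open import Data.Nat using (ℕ; zero; suc; _+_; _≤_; s≤s⁻¹)
open import Data.Nat.Properties using (≤-refl; ≤-trans; m≤m+n; m≤n+m; +-assoc; +-comm)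
open import Data.Fin using (Fin)
open import Data.Fin.Subset using (Subset; inside; _∈_; _∉_; _⊆_; _⊂_; _∪_; _∩_; _─_; ⁅_⁆; Nonempty; Empty) renaming (⊥ to ∅)
open import Data.Fin.Subset.Properties using (_∈?_; nonempty?; ⊆-refl; ⊆-antisym; ⊆-trans; x∈p∪q⁻; x∈p∪q⁺; x∈p∩q⁺; x∈p∩q⁻; x∈p∧x∉q⇒x∈p─q; p─q⊆p; p─q─r≡p─q∪r; x∈⁅x⁆; x∈⁅y⁆⇒x≡y; ∉⊥; ∪-assoc; ∪-identityˡ)
open import Data.Vec using (_∷_)
open import Data.Vec.Base using () renaming (here to vhere; there to vthere)
open import Data.List using (List; []; _∷_; _++_)
open import Data.List.Relation.Unary.All as All using (All; []; _∷_)
import Data.List.Relation.Unary.All.Properties as All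
open import Data.List.Relation.Unary.Any using (Any; here; there)
import Data.List.Relation.Unary.Any.Properties as Any
open import Data.List.Relation.Unary.AllPairs as AllPairs using (AllPairs; []; _∷_)
import Data.List.Relation.Unary.AllPairs.Properties as AllPairs
open import Data.List.Relation.Binary.Pointwise as Pointwise using (Pointwise; []; _∷_)
open import Data.List.Relation.Binary.Permutation.Propositional using (_↭_; refl; prep; swap; trans; ↭-refl; ↭-sym)
open import Data.List.Relation.Binary.Permutation.Propositional.Properties using (All-resp-↭; Any-resp-↭; ∈-resp-↭; shift; ↭-empty-inv)
open import Data.List.Relation.Binary.BagAndSetEquality using (∼bag⇒↭)
open import Data.List.Membership.Propositional using (find; lose) renaming (_∈_ to _∈ᴸ_)
open import Data.List.Membership.Propositional.Properties using (∈-++⁻; ∈-++⁺ˡ; ∈-++⁺ʳ)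
open import Data.List.Membership.Propositional.Properties.WithK using (unique∧set⇒bag)
open import Data.Product using (∃; _×_; _,_; proj₁; proj₂)
open import Data.Sum using (_⊎_; inj₁; inj₂)
open import Data.Empty using (⊥; ⊥-elim)
open import Function.Bundles using (mk⇔)
open import Relation.Nullary using (¬_; yes; no)
open import Relation.Binary.PropositionalEquality using (_≡_; _≢_; refl; sym; cong; subst; module ≡-Reasoning) renaming (trans to ≡-trans)

data Pointwise₃ {A B C : Set} (R : A → B → C → Set) : List A → List B → List C → Set where
  []  : Pointwise₃ R [] [] []
  _∷_ : ∀ {a b c as bs cs} → R a b c → Pointwise₃ R as bs cs →
        Pointwise₃ R (a ∷ as) (b ∷ bs) (c ∷ cs)

module _ {A B C : Set} {R : A → B → C → Set} where

  Pointwise₃-map : ∀ {R′ : A → B → C → Set} {as bs cs} →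
    (∀ {a b c} → a ∈ᴸ as → b ∈ᴸ bs → R a b c → R′ a b c) →
    Pointwise₃ R as bs cs → Pointwise₃ R′ as bs cs
  Pointwise₃-map f [] = []
  Pointwise₃-map f (r ∷ rs) = f (here refl) (here refl) r ∷ Pointwise₃-map (λ a b → f (there a) (there b)) rs

  Pointwise₃-outer : ∀ {S : A → C → Set} {as bs cs} →
    (∀ {a b c} → R a b c → S a c) → Pointwise₃ R as bs cs → Pointwise S as cs
  Pointwise₃-outer f [] = []
  Pointwise₃-outer f (r ∷ rs) = f r ∷ Pointwise₃-outer f rs

module _ {A B : Set} {R : A → B → Set} where

  Pointwise-∈ˡ : ∀ {as bs b} → Pointwise R as bs → b ∈ᴸ bs → ∃ λ a → a ∈ᴸ as × R a b
  Pointwise-∈ˡ (r ∷ rs) (here refl) = _ , here refl , r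
  Pointwise-∈ˡ (r ∷ rs) (there b∈) with Pointwise-∈ˡ rs b∈
  ... | a , a∈ , rab = a , there a∈ , rab

  Pointwise-∈ʳ : ∀ {as bs a} → Pointwise R as bs → a ∈ᴸ as → ∃ λ b → b ∈ᴸ bs × R a b
  Pointwise-∈ʳ (r ∷ rs) (here refl) = _ , here refl , r
  Pointwise-∈ʳ (r ∷ rs) (there a∈) with Pointwise-∈ʳ rs a∈
  ... | b , b∈ , rab = b , there b∈ , rab

  Pointwise-↭ : ∀ {as as′ bs′} → as ↭ as′ → Pointwise R as′ bs′ →
    ∃ λ bs → Pointwise R as bs × bs ↭ bs′
  Pointwise-↭ refl rs = _ , rs , refl
  Pointwise-↭ (prep a p) (r ∷ rs) with Pointwise-↭ p rs
  ... | bs , rs′ , q = _ , r ∷ rs′ , prep _ q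
  Pointwise-↭ (swap a a′ p) (r ∷ r′ ∷ rs) with Pointwise-↭ p rs
  ... | bs , rs′ , q = _ , r′ ∷ r ∷ rs′ , swap _ _ q
  Pointwise-↭ (trans p q) rs with Pointwise-↭ q rs
  ... | bs₁ , rs₁ , q₁ with Pointwise-↭ p rs₁
  ... | bs₂ , rs₂ , q₂ = bs₂ , rs₂ , trans q₂ q₁

  data Picked (P : A → Set) (as : List A) (bs : List B) : Set where
    picked : ∀ {a b as′ bs′} → as ↭ a ∷ as′ → bs ↭ b ∷ bs′ →
             R a b → Pointwise R as′ bs′ → P a → Picked P as bs

  pick : ∀ {P : A → Set} {as bs} → Pointwise R as bs → Any P as → Picked P as bs
  pick (r ∷ rs) (here pa) = picked refl refl r rs pa
  pick (r ∷ rs) (there any) with pick rs any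
  ... | picked p q r′ rs′ pa =
    picked (trans (prep _ p) (swap _ _ refl)) (trans (prep _ q) (swap _ _ refl)) r′ (r ∷ rs′) pa

AllPairs-resp-↭ : ∀ {A : Set} {R : A → A → Set} → (∀ {x y} → R x y → R y x) →
  ∀ {xs ys} → xs ↭ ys → AllPairs R xs → AllPairs R ys
AllPairs-resp-↭ R-sym refl rs = rs
AllPairs-resp-↭ R-sym (prep x p) (r ∷ rs) = All-resp-↭ p r ∷ AllPairs-resp-↭ R-sym p rs
AllPairs-resp-↭ R-sym (swap x y p) ((rxy ∷ rx) ∷ ry ∷ rs) =
  (R-sym rxy ∷ All-resp-↭ p ry) ∷ All-resp-↭ p rx ∷ AllPairs-resp-↭ R-sym p rs
AllPairs-resp-↭ R-sym (trans p q) rs = AllPairs-resp-↭ R-sym q (AllPairs-resp-↭ R-sym p rs)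

module _ {n : ℕ} where

  x∈p─q⇒x∉q : ∀ {k} (p q : Subset k) {x} → x ∈ p ─ q → x ∉ q
  x∈p─q⇒x∉q (_ ∷ p) (_ ∷ q) (vthere m) (vthere m′) = x∈p─q⇒x∉q p q m m′
  x∈p─q⇒x∉q (_ ∷ p) (inside ∷ q) () vhere

  x∈p─q⁻ : ∀ {p q : Subset n} {x} → x ∈ p ─ q → x ∈ p × x ∉ q
  x∈p─q⁻ {p} {q} m = p─q⊆p p q m , x∈p─q⇒x∉q p q m

  x∈p─q∪r⁻ : ∀ {p q r : Subset n} {x} → x ∈ p ─ (q ∪ r) → x ∈ p ─ q × x ∉ r
  x∈p─q∪r⁻ {p} {q} {r} m = x∈p─q⁻ (subst (_ ∈_) (sym (p─q─r≡p─q∪r p q r)) m)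

  x∈p─q∪r⁺ : ∀ {p q r : Subset n} {x} → x ∈ p ─ q → x ∉ r → x ∈ p ─ (q ∪ r)
  x∈p─q∪r⁺ {p} {q} {r} m x∉r = subst (_ ∈_) (p─q─r≡p─q∪r p q r) (x∈p∧x∉q⇒x∈p─q m x∉r)

  ∪-⊆ : ∀ {p q r : Subset n} → p ⊆ r → q ⊆ r → p ∪ q ⊆ r
  ∪-⊆ {p} {q} p⊆r q⊆r m with x∈p∪q⁻ p q m
  ... | inj₁ x∈p = p⊆r x∈p
  ... | inj₂ x∈q = q⊆r x∈q

  ∩∪─ : ∀ (p q : Subset n) → (p ∩ q) ∪ (p ─ q) ≡ p
  ∩∪─ p q = ⊆-antisym (∪-⊆ (λ m → proj₁ (x∈p∩q⁻ p q m)) (p─q⊆p p q)) split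
    where
    split : p ⊆ (p ∩ q) ∪ (p ─ q)
    split {x} x∈p with x ∈? q
    ... | yes x∈q = x∈p∪q⁺ (inj₁ (x∈p∩q⁺ (x∈p , x∈q)))
    ... | no x∉q = x∈p∪q⁺ (inj₂ (x∈p∧x∉q⇒x∈p─q x∈p x∉q))

  empty-─⇒⊆ : ∀ {p q : Subset n} → ¬ Nonempty (p ─ q) → p ⊆ q
  empty-─⇒⊆ {p} {q} empty {x} x∈p with x ∈? q
  ... | yes x∈q = x∈q
  ... | no x∉q = ⊥-elim (empty (x , x∈p∧x∉q⇒x∈p─q x∈p x∉q))

  ⁅⁆-⊆ : ∀ {x : Fin n} {p} → x ∈ p → ⁅ x ⁆ ⊆ p
  ⁅⁆-⊆ {x} {p} x∈p {y} y∈⁅x⁆ = subst (_∈ p) (sym (x∈⁅y⁆⇒x≡y x y∈⁅x⁆)) x∈p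

  ⊆-─-≢ : ∀ {G Y Z : Subset n} → Nonempty Y → Y ⊆ G → Z ⊆ G ─ Y → Z ≢ G
  ⊆-─-≢ (y , y∈Y) Y⊆G Z⊆G─Y refl = proj₂ (x∈p─q⁻ (Z⊆G─Y (Y⊆G y∈Y))) y∈Y

  Disjoint : Subset n → Subset n → Set
  Disjoint p q = Empty (p ∩ q)

  disjoint-sym : ∀ {p q} → Disjoint p q → Disjoint q p
  disjoint-sym {p} {q} d (x , m) with x∈p∩q⁻ q p m
  ... | x∈q , x∈p = d (x , x∈p∩q⁺ (x∈p , x∈q))

  disjoint-⊆ : ∀ {p p′ q} → p′ ⊆ p → Disjoint p q → Disjoint p′ q
  disjoint-⊆ {p} {p′} {q} p′⊆p d (x , m) with x∈p∩q⁻ p′ q m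
  ... | x∈p′ , x∈q = d (x , x∈p∩q⁺ (p′⊆p x∈p′ , x∈q))

  disjoint-family-≡ : ∀ {Cs C D x} → AllPairs Disjoint Cs → C ∈ᴸ Cs → D ∈ᴸ Cs →
    x ∈ C → x ∈ D → C ≡ D
  disjoint-family-≡ (d ∷ ds) (here refl) (here refl) _ _ = refl
  disjoint-family-≡ (d ∷ ds) (here refl) (there D∈) x∈C x∈D =
    ⊥-elim (All.lookup d D∈ (_ , x∈p∩q⁺ (x∈C , x∈D)))
  disjoint-family-≡ (d ∷ ds) (there C∈) (here refl) x∈C x∈D =
    ⊥-elim (All.lookup d C∈ (_ , x∈p∩q⁺ (x∈D , x∈C)))
  disjoint-family-≡ (d ∷ ds) (there C∈) (there D∈) x∈C x∈D = disjoint-family-≡ ds C∈ D∈ x∈C x∈D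

  disjoint-family-distinct : ∀ {Cs} → All Nonempty Cs → AllPairs Disjoint Cs → AllPairs _≢_ Cs
  disjoint-family-distinct [] [] = []
  disjoint-family-distinct ((x , x∈C) ∷ nes) (d ∷ ds) =
    All.map (λ dCD C≡D → dCD (x , x∈p∩q⁺ (x∈C , subst (x ∈_) C≡D x∈C))) d ∷ disjoint-family-distinct nes ds

module _ {n : ℕ} where

  -- The number of nodes, which decreases under rule (i).
  mutual
    size : Tree n → ℕ
    size (node Y ts) = suc (sizeL ts)

    sizeL : List (Tree n) → ℕ
    sizeL [] = 0
    sizeL (t ∷ ts) = size t + sizeL ts

  size-∈ : ∀ {t : Tree n} {ts} → t ∈ᴸ ts → size t ≤ sizeL ts
  size-∈ {ts = t ∷ ts} (here refl) = m≤m+n (size t) (sizeL ts)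
  size-∈ {ts = t ∷ ts} (there t∈) = ≤-trans (size-∈ t∈) (m≤n+m (sizeL ts) (size t))

  sizeL-++ : ∀ (ts us : List (Tree n)) → sizeL (ts ++ us) ≡ sizeL ts + sizeL us
  sizeL-++ [] us = refl
  sizeL-++ (t ∷ ts) us = ≡-trans (cong (size t +_) (sizeL-++ ts us)) (sym (+-assoc (size t) (sizeL ts) (sizeL us)))

  sizeL-↭ : ∀ {ts us : List (Tree n)} → ts ↭ us → sizeL ts ≡ sizeL us
  sizeL-↭ refl = refl
  sizeL-↭ (prep t p) = cong (size t +_) (sizeL-↭ p)
  sizeL-↭ {ts = t ∷ u ∷ ts} {u′ ∷ t′ ∷ us} (swap _ _ p) = begin
    size t + (size u + sizeL ts)  ≡⟨ sym (+-assoc (size t) (size u) (sizeL ts)) ⟩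
    (size t + size u) + sizeL ts  ≡⟨ cong (_+ sizeL ts) (+-comm (size t) (size u)) ⟩
    (size u + size t) + sizeL ts  ≡⟨ +-assoc (size u) (size t) (sizeL ts) ⟩
    size u + (size t + sizeL ts)  ≡⟨ cong (λ s → size u + (size t + s)) (sizeL-↭ p) ⟩
    size u + (size t + sizeL us)  ∎
    where open ≡-Reasoning
  sizeL-↭ (trans p q) = ≡-trans (sizeL-↭ p) (sizeL-↭ q)

  size-merge : ∀ {X : Subset n} {ts t₁s ts′} → ts ↭ node X t₁s ∷ ts′ →
    sizeL ts ≡ suc (sizeL (t₁s ++ ts′))
  size-merge {t₁s = t₁s} {ts′} p = ≡-trans (sizeL-↭ p) (cong suc (sym (sizeL-++ t₁s ts′)))

  upList-∈⁻ : ∀ {x : Fin n} ts → x ∈ upList ts → Any (λ t → x ∈ up t) ts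
  upList-∈⁻ [] m = ⊥-elim (∉⊥ m)
  upList-∈⁻ (t ∷ ts) m with x∈p∪q⁻ (up t) (upList ts) m
  ... | inj₁ x∈t = here x∈t
  ... | inj₂ x∈ts = there (upList-∈⁻ ts x∈ts)

  upList-∈⁺ : ∀ {x : Fin n} {ts} → Any (λ t → x ∈ up t) ts → x ∈ upList ts
  upList-∈⁺ (here x∈t) = x∈p∪q⁺ (inj₁ x∈t)
  upList-∈⁺ (there x∈ts) = x∈p∪q⁺ (inj₂ (upList-∈⁺ x∈ts))

  upList-↭ : ∀ {ts us : List (Tree n)} → ts ↭ us → upList ts ≡ upList us
  upList-↭ {ts} {us} p = ⊆-antisym
    (λ m → upList-∈⁺ (Any-resp-↭ p (upList-∈⁻ ts m)))
    (λ m → upList-∈⁺ (Any-resp-↭ (↭-sym p) (upList-∈⁻ us m)))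

  upList-++ : ∀ (ts us : List (Tree n)) → upList (ts ++ us) ≡ upList ts ∪ upList us
  upList-++ [] us = sym (∪-identityˡ (upList us))
  upList-++ (t ∷ ts) us = ≡-trans (cong (up t ∪_) (upList-++ ts us)) (sym (∪-assoc (up t) (upList ts) (upList us)))

  up-merge : ∀ {Y X : Subset n} {ts us t₁s t₂s} → ts ↭ node X t₁s ∷ t₂s → us ↭ t₁s ++ t₂s →
    up (node Y ts) ≡ up (node (Y ∪ X) us)
  up-merge {Y} {X} {ts} {us} {t₁s} {t₂s} p q = begin
    Y ∪ upList ts                               ≡⟨ cong (Y ∪_) (upList-↭ p) ⟩
    Y ∪ ((X ∪ upList t₁s) ∪ upList t₂s)         ≡⟨ cong (Y ∪_) (∪-assoc X (upList t₁s) (upList t₂s)) ⟩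
    Y ∪ (X ∪ (upList t₁s ∪ upList t₂s))         ≡⟨ sym (∪-assoc Y X _) ⟩
    (Y ∪ X) ∪ (upList t₁s ∪ upList t₂s)         ≡⟨ cong ((Y ∪ X) ∪_) (sym (upList-++ t₁s t₂s)) ⟩
    (Y ∪ X) ∪ upList (t₁s ++ t₂s)               ≡⟨ cong ((Y ∪ X) ∪_) (upList-↭ (↭-sym q)) ⟩
    (Y ∪ X) ∪ upList us                         ∎
    where open ≡-Reasoning

  up-replace : ∀ {Y : Subset n} {t t′ ts ts′ t₂s} → up t ≡ up t′ → ts ↭ t ∷ t₂s → ts′ ↭ t′ ∷ t₂s →
    up (node Y ts) ≡ up (node Y ts′)
  up-replace {Y} {t₂s = t₂s} eq p p′ =
    cong (Y ∪_) (≡-trans (upList-↭ p) (≡-trans (cong (_∪ upList t₂s) eq) (upList-↭ (↭-sym p′))))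

  psi-top : ∀ (t : Tree n) → InPsi (up t) t
  psi-top (node Y ts) = here refl

  psi-merge⁺ : ∀ {Z Y X : Subset n} {ts us t₁s t₂s} → ts ↭ node X t₁s ∷ t₂s → us ↭ t₁s ++ t₂s →
    InPsi Z (node (Y ∪ X) us) → InPsi Z (node Y ts)
  psi-merge⁺ p q (here eq) = here (≡-trans eq (sym (up-merge p q)))
  psi-merge⁺ {t₁s = t₁s} p q (there t∈us ip) with ∈-++⁻ t₁s (∈-resp-↭ q t∈us)
  ... | inj₁ t∈t₁s = there (∈-resp-↭ (↭-sym p) (here refl)) (there t∈t₁s ip)
  ... | inj₂ t∈t₂s = there (∈-resp-↭ (↭-sym p) (there t∈t₂s)) ip

  psi-replace : ∀ {Y : Subset n} {t t′ ts ts′ t₂s} → up t ≡ up t′ → t′ ⊆ψ t →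
    ts ↭ t ∷ t₂s → ts′ ↭ t′ ∷ t₂s → node Y ts′ ⊆ψ node Y ts
  psi-replace eq t′⊆ψt p p′ Z (here eq′) = here (≡-trans eq′ (sym (up-replace eq p p′)))
  psi-replace eq t′⊆ψt p p′ Z (there u∈ts′ ip) with ∈-resp-↭ p′ u∈ts′
  ... | here refl = there (∈-resp-↭ (↭-sym p) (here refl)) (t′⊆ψt Z ip)
  ... | there u∈t₂s = there (∈-resp-↭ (↭-sym p) (there u∈t₂s)) ip

  psi-merge⁻ : ∀ {Z Y X : Subset n} {ts us t₁s t₂s} → ts ↭ node X t₁s ∷ t₂s → us ↭ t₁s ++ t₂s →
    InPsi Z (node Y ts) → Z ≡ up (node X t₁s) ⊎ InPsi Z (node (Y ∪ X) us)
  psi-merge⁻ p q (here eq) = inj₂ (here (≡-trans eq (up-merge p q)))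
  psi-merge⁻ {t₁s = t₁s} p q (there t∈ts ip) with ∈-resp-↭ p t∈ts
  ... | there t∈t₂s = inj₂ (there (∈-resp-↭ (↭-sym q) (∈-++⁺ʳ t₁s t∈t₂s)) ip)
  ... | here refl with ip
  ...   | here eq = inj₁ eq
  ...   | there t∈t₁s ip′ = inj₂ (there (∈-resp-↭ (↭-sym q) (∈-++⁺ˡ t∈t₁s)) ip′)

module _ {n : ℕ} {E : Edges n} where

  le-up : ∀ {G S T} → Le E G S T → up S ≡ up T
  le-up le-refl = refl
  le-up (le-trans p q) = ≡-trans (le-up p) (le-up q)
  le-up (le-merge _ _ _ _ _ _ _ _ p q) = up-merge p q
  le-up (le-sub _ _ _ _ _ l p p′) = up-replace (le-up l) p p′

  le-psi : ∀ {G S T} → Le E G S T → T ⊆ψ S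
  le-psi le-refl Z i = i
  le-psi (le-trans p q) Z i = le-psi p Z (le-psi q Z i)
  le-psi (le-merge _ _ _ _ _ _ _ _ p q) Z i = psi-merge⁺ p q i
  le-psi (le-sub _ _ _ _ _ l p p′) = psi-replace (le-up l) (le-psi l) p p′

module Converse {n : ℕ} (E : Edges n) (H : Subset n)
                (no-empty-edge : ¬ IsEdge E ∅) (atomic : Atomic E H) where

  IsC : Subset n → Tree n → Set
  IsC = IsConstruct E

  PWC : List (Subset n) → List (Tree n) → Set
  PWC = Pointwise IsC

  singleton-edge : ∀ {A x} → A ⊆ H → x ∈ A → ∃ λ Z → IsEdge E Z × Z ⊆ A × x ∈ Z
  singleton-edge A⊆H x∈A = ⁅ _ ⁆ , atomic _ (A⊆H x∈A) , ⁅⁆-⊆ x∈A , x∈⁅x⁆ _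

  module _ {G Y : Subset n} {Cs : List (Subset n)} (c : Components E G Y Cs) where

    comp-nonempty : All Nonempty Cs
    comp-nonempty = proj₁ c

    comp-disjoint : AllPairs Disjoint Cs
    comp-disjoint = proj₁ (proj₂ c)

    comp-vertices : ∀ x → (Any (x ∈_) Cs → ∃ λ Z → IsEdge E Z × Z ⊆ G ─ Y × x ∈ Z)
                        × ((∃ λ Z → IsEdge E Z × Z ⊆ G ─ Y × x ∈ Z) → Any (x ∈_) Cs)
    comp-vertices = proj₁ (proj₂ (proj₂ c))

    comp-sound : ∀ {x} → Any (x ∈_) Cs → x ∈ G ─ Y
    comp-sound {x} x∈Cs with proj₁ (comp-vertices x) x∈Cs
    ... | Z , _ , Z⊆G─Y , x∈Z = Z⊆G─Y x∈Z

    -- atomicity: the components cover G ∖ Y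
    comp-complete : G ⊆ H → ∀ {x} → x ∈ G ─ Y → Any (x ∈_) Cs
    comp-complete G⊆H {x} x∈G─Y =
      proj₂ (comp-vertices x) (singleton-edge (⊆-trans (p─q⊆p G Y) G⊆H) x∈G─Y)

    comp-edge : ∀ Z → IsEdge E Z → Z ⊆ G ─ Y → Any (Z ⊆_) Cs
    comp-edge = proj₁ (proj₂ (proj₂ (proj₂ c)))

    comp-connected : All (Connected E) Cs
    comp-connected = proj₂ (proj₂ (proj₂ (proj₂ c)))

    comp-⊆ : ∀ {C} → C ∈ᴸ Cs → C ⊆ G ─ Y
    comp-⊆ C∈ x∈C = comp-sound (lose C∈ x∈C)

    comp-⊆H : G ⊆ H → ∀ {C} → C ∈ᴸ Cs → C ⊆ H
    comp-⊆H G⊆H C∈ = ⊆-trans (⊆-trans (comp-⊆ C∈) (p─q⊆p G Y)) G⊆H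

  mk-components : ∀ {G Y Cs} → G ⊆ H →
    All Nonempty Cs → AllPairs Disjoint Cs →
    (∀ {x} → Any (x ∈_) Cs → x ∈ G ─ Y) → (∀ {x} → x ∈ G ─ Y → Any (x ∈_) Cs) →
    (∀ Z → IsEdge E Z → Z ⊆ G ─ Y → Any (Z ⊆_) Cs) → All (Connected E) Cs →
    Components E G Y Cs
  mk-components {G} {Y} G⊆H nes ds sound complete edges conns =
    nes , ds ,
    (λ x → (λ x∈Cs → singleton-edge (⊆-trans (p─q⊆p G Y) G⊆H) (sound x∈Cs)) ,
           (λ { (Z , _ , Z⊆ , x∈Z) → complete (Z⊆ x∈Z) })) ,
    edges , conns

  components-↭ : ∀ {G Y Cs Ds} → Components E G Y Cs → Cs ↭ Ds → Components E G Y Ds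
  components-↭ c p =
    All-resp-↭ p (comp-nonempty c) , AllPairs-resp-↭ disjoint-sym p (comp-disjoint c) ,
    (λ x → (λ x∈Ds → proj₁ (comp-vertices c x) (Any-resp-↭ (↭-sym p) x∈Ds)) ,
           (λ w → Any-resp-↭ p (proj₂ (comp-vertices c x) w))) ,
    (λ Z e Z⊆ → Any-resp-↭ p (comp-edge c Z e Z⊆)) ,
    All-resp-↭ p (comp-connected c)

  components-whole : ∀ {C} → Components E C C []
  components-whole {C} =
    [] , [] ,
    (λ x → (λ ()) , λ { (Z , _ , Z⊆ , x∈Z) → ⊥-elim (outside (Z⊆ x∈Z)) }) ,
    (λ Z e Z⊆ → ⊥-elim (no-empty-edge (subst (IsEdge E) (empty Z⊆) e))) ,
    []
    where
    outside : ∀ {x} → x ∈ C ─ C → ⊥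
    outside m = proj₂ (x∈p─q⁻ m) (proj₁ (x∈p─q⁻ m))
    empty : ∀ {Z} → Z ⊆ C ─ C → Z ≡ ∅
    empty Z⊆ = ⊆-antisym (λ m → ⊥-elim (outside (Z⊆ m))) (λ m → ⊥-elim (∉⊥ m))

  components-merge : ∀ {G Y C Rs X Hs} → G ⊆ H → Components E G Y (C ∷ Rs) → X ⊆ C →
    Components E C X Hs → Components E G (Y ∪ X) (Hs ++ Rs)
  components-merge {G} {Y} {C} {Rs} {X} {Hs} G⊆H cY X⊆C cX = mk-components G⊆H
    (All.++⁺ (comp-nonempty cX) (All.tail (comp-nonempty cY)))
    (AllPairs.++⁺ (comp-disjoint cX) (AllPairs.tail (comp-disjoint cY)) cross)
    sound complete edges
    (All.++⁺ (comp-connected cX) (All.tail (comp-connected cY)))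
    where
    C-disjoint : All (Disjoint C) Rs
    C-disjoint = AllPairs.head (comp-disjoint cY)
    H⊆C : ∀ {D} → D ∈ᴸ Hs → D ⊆ C
    H⊆C D∈ = ⊆-trans (comp-⊆ cX D∈) (p─q⊆p C X)
    cross : All (λ D → All (Disjoint D) Rs) Hs
    cross = All.tabulate (λ D∈ → All.map (disjoint-⊆ (H⊆C D∈)) C-disjoint)
    sound : ∀ {x} → Any (x ∈_) (Hs ++ Rs) → x ∈ G ─ (Y ∪ X)
    sound x∈ with Any.++⁻ Hs x∈
    ... | inj₁ x∈Hs = let x∈C , x∉X = x∈p─q⁻ (comp-sound cX x∈Hs) in
                      x∈p─q∪r⁺ (comp-sound cY (here x∈C)) x∉X
    ... | inj₂ x∈Rs with find x∈Rs
    ...   | R , R∈ , x∈R = x∈p─q∪r⁺ (comp-sound cY (there x∈Rs))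
                             (λ x∈X → All.lookup C-disjoint R∈ (_ , x∈p∩q⁺ (X⊆C x∈X , x∈R)))
    complete : ∀ {x} → x ∈ G ─ (Y ∪ X) → Any (x ∈_) (Hs ++ Rs)
    complete x∈ with x∈p─q∪r⁻ x∈
    ... | x∈G─Y , x∉X with comp-complete cY G⊆H x∈G─Y
    ...   | here x∈C = Any.++⁺ˡ (comp-complete cX (comp-⊆H cY G⊆H (here refl)) (x∈p∧x∉q⇒x∈p─q x∈C x∉X))
    ...   | there x∈Rs = Any.++⁺ʳ Hs x∈Rs
    edges : ∀ Z → IsEdge E Z → Z ⊆ G ─ (Y ∪ X) → Any (Z ⊆_) (Hs ++ Rs)
    edges Z e Z⊆ with comp-edge cY Z e (λ m → proj₁ (x∈p─q∪r⁻ (Z⊆ m)))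
    ... | here Z⊆C = Any.++⁺ˡ (comp-edge cX Z e (λ m → x∈p∧x∉q⇒x∈p─q (Z⊆C m) (proj₂ (x∈p─q∪r⁻ (Z⊆ m)))))
    ... | there Z⊆Rs = Any.++⁺ʳ Hs Z⊆Rs

  connected-⊆ : ∀ {C D} → Connected E C → Nonempty (C ∩ D) →
    (∀ Z → IsEdge E Z → Z ⊆ C → Z ⊆ D ⊎ Disjoint Z D) → C ⊆ D
  connected-⊆ {C} {D} conn meet edge-split {y} y∈C with y ∈? D
  ... | yes y∈D = y∈D
  ... | no y∉D = ⊥-elim (conn (C ∩ D) (C ─ D) meet (y , x∈p∧x∉q⇒x∈p─q y∈C y∉D) apart (∩∪─ C D) edges)
    where
    apart : Disjoint (C ∩ D) (C ─ D)
    apart (z , m) with x∈p∩q⁻ (C ∩ D) (C ─ D) m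
    ... | z∈C∩D , z∈C─D = proj₂ (x∈p─q⁻ z∈C─D) (proj₂ (x∈p∩q⁻ C D z∈C∩D))
    edges : ∀ Z → IsEdge E Z → Z ⊆ C → Z ⊆ C ∩ D ⊎ Z ⊆ C ─ D
    edges Z e Z⊆C with edge-split Z e Z⊆C
    ... | inj₁ Z⊆D = inj₁ (λ m → x∈p∩q⁺ (Z⊆C m , Z⊆D m))
    ... | inj₂ Z∩D=∅ = inj₂ (λ {z} m → x∈p∧x∉q⇒x∈p─q (Z⊆C m) (λ z∈D → Z∩D=∅ (z , x∈p∩q⁺ (m , z∈D))))

  component-∈ : ∀ {G Y Cs Ds C} → G ⊆ H → Components E G Y Cs → Components E G Y Ds →
    C ∈ᴸ Cs → C ∈ᴸ Ds
  component-∈ G⊆H cC cD C∈ with All.lookup (comp-nonempty cC) C∈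
  ... | x , x∈C with find (comp-complete cD G⊆H (comp-⊆ cC C∈ x∈C))
  ... | D , D∈ , x∈D = subst (_∈ᴸ _) (⊆-antisym (meets-⊆ cD cC D∈ C∈ x∈D x∈C) (meets-⊆ cC cD C∈ D∈ x∈C x∈D)) D∈
    where
    meets-⊆ : ∀ {G Y Cs Ds C D x} → Components E G Y Cs → Components E G Y Ds →
             C ∈ᴸ Cs → D ∈ᴸ Ds → x ∈ C → x ∈ D → C ⊆ D
    meets-⊆ {C = C} {D} cC cD C∈ D∈ x∈C x∈D =
      connected-⊆ (All.lookup (comp-connected cC) C∈) (_ , x∈p∩q⁺ (x∈C , x∈D)) edge-split
      where
      edge-split : ∀ Z → IsEdge E Z → Z ⊆ C → Z ⊆ D ⊎ Disjoint Z D
      edge-split Z e Z⊆C with find (comp-edge cD Z e (λ m → comp-⊆ cC C∈ (Z⊆C m))) | nonempty? (Z ∩ D)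
      ... | D′ , D′∈ , Z⊆D′ | yes (z , m) =
            let z∈Z , z∈D = x∈p∩q⁻ Z D m in
            inj₁ (subst (Z ⊆_) (disjoint-family-≡ (comp-disjoint cD) D′∈ D∈ (Z⊆D′ z∈Z) z∈D) Z⊆D′)
      ... | _ | no Z∩D=∅ = inj₂ Z∩D=∅

  components-unique : ∀ {G Y Cs Ds} → G ⊆ H → Components E G Y Cs → Components E G Y Ds → Cs ↭ Ds
  components-unique G⊆H cC cD = ∼bag⇒↭ (unique∧set⇒bag
    (disjoint-family-distinct (comp-nonempty cC) (comp-disjoint cC))
    (disjoint-family-distinct (comp-nonempty cD) (comp-disjoint cD))
    (mk⇔ (component-∈ G⊆H cC cD) (component-∈ G⊆H cD cC)))

  label-nonempty : ∀ {G Y ts} → IsC G (node Y ts) → Nonempty Y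
  label-nonempty (leaf ne _) = ne
  label-nonempty (step ne _ _ _) = ne

  label-⊆ : ∀ {G Y ts} → IsC G (node Y ts) → Y ⊆ G
  label-⊆ (leaf _ refl) m = m
  label-⊆ (step _ Y⊂G _ _) m = proj₁ Y⊂G m

  construct : ∀ {G Y Cs ts} → Nonempty Y → Y ⊆ G → Components E G Y Cs → PWC Cs ts → IsC G (node Y ts)
  construct {G} {Y} ne Y⊆G c pw with nonempty? (G ─ Y)
  ... | yes (x , x∈G─Y) = step ne (Y⊆G , x , x∈p─q⁻ x∈G─Y) c pw
  construct ne Y⊆G c [] | no G⊆Y = leaf ne (⊆-antisym Y⊆G (empty-─⇒⊆ G⊆Y))
  construct ne Y⊆G c (_ ∷ _) | no G⊆Y with All.lookup (comp-nonempty c) (here refl)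
  ... | x , x∈C = ⊥-elim (G⊆Y (x , comp-⊆ c (here refl) x∈C))

  record Unfolded (C : Subset n) (t : Tree n) : Set where
    constructor unfolded
    field
      {X} : Subset n
      {t₁s} : List (Tree n)
      {Hs} : List (Subset n)
      shape : t ≡ node X t₁s
      X-nonempty : Nonempty X
      X⊆C : X ⊆ C
      X-components : Components E C X Hs
      child-constructs : PWC Hs t₁s

  unfold : ∀ {C t} → IsC C t → Unfolded C t
  unfold (leaf ne refl) = unfolded refl ne ⊆-refl components-whole []
  unfold (step ne X⊂C c pw) = unfolded refl ne (proj₁ X⊂C) c pw

  mutual
    up-⊆ : ∀ {G t} → IsC G t → up t ⊆ G
    up-⊆ (leaf _ refl) m with x∈p∪q⁻ _ ∅ m
    ... | inj₁ x∈G = x∈G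
    ... | inj₂ x∈∅ = ⊥-elim (∉⊥ x∈∅)
    up-⊆ (step _ Y⊂G c pw) m with x∈p∪q⁻ _ _ m
    ... | inj₁ x∈Y = proj₁ Y⊂G x∈Y
    ... | inj₂ x∈ts = proj₁ (x∈p─q⁻ (comp-sound c (upList-⊆ pw x∈ts)))

    upList-⊆ : ∀ {Cs ts x} → PWC Cs ts → x ∈ upList ts → Any (x ∈_) Cs
    upList-⊆ [] m = ⊥-elim (∉⊥ m)
    upList-⊆ (r ∷ rs) m with x∈p∪q⁻ _ _ m
    ... | inj₁ x∈t = here (up-⊆ r x∈t)
    ... | inj₂ x∈ts = there (upList-⊆ rs x∈ts)

  mutual
    up-⊇ : ∀ {G t} → G ⊆ H → IsC G t → G ⊆ up t
    up-⊇ G⊆H (leaf _ refl) x∈G = x∈p∪q⁺ (inj₁ x∈G)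
    up-⊇ {G} G⊆H (step {Y = Y} _ _ c pw) {x} x∈G with x ∈? Y
    ... | yes x∈Y = x∈p∪q⁺ (inj₁ x∈Y)
    ... | no x∉Y = x∈p∪q⁺ (inj₂ (upList-⊇ (comp-⊆H c G⊆H) pw (comp-complete c G⊆H (x∈p∧x∉q⇒x∈p─q x∈G x∉Y))))

    upList-⊇ : ∀ {Cs ts x} → (∀ {C} → C ∈ᴸ Cs → C ⊆ H) → PWC Cs ts → Any (x ∈_) Cs → x ∈ upList ts
    upList-⊇ Cs⊆H (r ∷ rs) (here x∈C) = x∈p∪q⁺ (inj₁ (up-⊇ (Cs⊆H (here refl)) r x∈C))
    upList-⊇ Cs⊆H (r ∷ rs) (there x∈Cs) = x∈p∪q⁺ (inj₂ (upList-⊇ (λ C∈ → Cs⊆H (there C∈)) rs x∈Cs))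

  up-≡ : ∀ {G t} → G ⊆ H → IsC G t → up t ≡ G
  up-≡ G⊆H ct = ⊆-antisym (up-⊆ ct) (up-⊇ G⊆H ct)

  psi-⊆ : ∀ {G t Z} → IsC G t → InPsi Z t → Z ⊆ G
  psi-⊆ ct (here eq) m = up-⊆ ct (subst (_ ∈_) eq m)
  psi-⊆ (step _ Y⊂G c pw) (there t∈ ip) with Pointwise-∈ˡ pw t∈
  ... | C , C∈ , ct = λ m → proj₁ (x∈p─q⁻ (comp-⊆ c C∈ (psi-⊆ ct ip m)))

  psi-nonempty : ∀ {G t Z} → IsC G t → InPsi Z t → Nonempty Z
  psi-nonempty ct (here eq) with label-nonempty ct
  ... | x , x∈Y = x , subst (x ∈_) (sym eq) (x∈p∪q⁺ (inj₁ x∈Y))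
  psi-nonempty (step _ _ _ pw) (there t∈ ip) with Pointwise-∈ˡ pw t∈
  ... | C , C∈ , ct = psi-nonempty ct ip

  psi-root : ∀ {G Y ts Z} → G ⊆ H → IsC G (node Y ts) → InPsi Z (node Y ts) → Z ≡ G ⊎ Z ⊆ G ─ Y
  psi-root G⊆H cS (here eq) = inj₁ (≡-trans eq (up-≡ G⊆H cS))
  psi-root G⊆H (step _ _ c pw) (there t∈ ip) with Pointwise-∈ˡ pw t∈
  ... | C , C∈ , ct = inj₂ (λ m → comp-⊆ c C∈ (psi-⊆ ct ip m))

  psi-component : ∀ {G Y Cs ts C} → G ⊆ H → Components E G Y Cs → PWC Cs ts → C ∈ᴸ Cs →
    InPsi C (node Y ts)
  psi-component G⊆H c pw C∈ with Pointwise-∈ʳ pw C∈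
  ... | t , t∈ , ct = there t∈ (subst (λ W → InPsi W t) (up-≡ (comp-⊆H c G⊆H C∈) ct) (psi-top t))

  component-∉ψ : ∀ {G Y C Y′ us x} → G ⊆ H → Nonempty Y → Y ⊆ G → C ⊆ G ─ Y →
    IsC G (node Y′ us) → x ∈ C → x ∈ Y′ → ¬ InPsi C (node Y′ us)
  component-∉ψ G⊆H neY Y⊆G C⊆ cT x∈C x∈Y′ i with psi-root G⊆H cT i
  ... | inj₁ C≡G = ⊆-─-≢ neY Y⊆G C⊆ C≡G
  ... | inj₂ C⊆G─Y′ = proj₂ (x∈p─q⁻ (C⊆G─Y′ x∈C)) x∈Y′

  root-⊆ : ∀ {G Y ts Y′ us} → G ⊆ H → IsC G (node Y ts) → IsC G (node Y′ us) →
    node Y′ us ⊆ψ node Y ts → Y ⊆ Y′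
  root-⊆ G⊆H cS (leaf _ refl) incl = label-⊆ cS
  root-⊆ G⊆H cS (step {Y = Y′} neY′ Y′⊂G cD pwD) incl {x} x∈Y with x ∈? Y′
  ... | yes x∈Y′ = x∈Y′
  ... | no x∉Y′ with find (comp-complete cD G⊆H (x∈p∧x∉q⇒x∈p─q (label-⊆ cS x∈Y) x∉Y′))
  ... | D , D∈ , x∈D = ⊥-elim (component-∉ψ G⊆H neY′ (proj₁ Y′⊂G) (comp-⊆ cD D∈) cS x∈D x∈Y
                                 (incl D (psi-component G⊆H cD pwD D∈)))

  -- Children are ordered up to permutation: reordering is an instance of rule (ii).
  le-reorder : ∀ {G Y Cs vs ts us} → Nonempty Y → Y ⊂ G → Components E G Y Cs → PWC Cs vs →
    ts ↭ vs → us ↭ vs → Le E G (node Y ts) (node Y us)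
  le-reorder neY Y⊂G c [] p q with ↭-empty-inv p | ↭-empty-inv q
  ... | refl | refl = le-refl
  le-reorder neY Y⊂G c (r ∷ rs) p q = le-sub neY Y⊂G c r rs le-refl p q

  Refines : Subset n → Tree n → Tree n → Set
  Refines C t u = IsC C t × IsC C u × Le E C t u

  -- Replacing the children one at a time by larger ones (rule (ii));
  -- the children vs of the components Ds have already been replaced.
  le-children : ∀ {G Y Ds Cs vs ts us ts′ us′} → Nonempty Y → Y ⊂ G →
    Components E G Y (Ds ++ Cs) → PWC Ds vs → Pointwise₃ Refines Cs ts us →
    ts′ ↭ vs ++ ts → us′ ↭ vs ++ us → Le E G (node Y ts′) (node Y us′)
  le-children neY Y⊂G c pwD [] p q = le-reorder neY Y⊂G c (Pointwise.++⁺ pwD []) p q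
  le-children {G} {Y} {Ds} {C ∷ Cs} {vs} {t ∷ ts} {u ∷ us} neY Y⊂G c pwD ((ct , cu , t≤u) ∷ rest) p q =
    le-trans (le-children neY Y⊂G c′ (ct ∷ pwD) rest (trans p (shift t vs ts)) ↭-refl)
             (le-sub neY Y⊂G c′ ct (Pointwise.++⁺ pwD (Pointwise₃-outer (λ r → proj₁ (proj₂ r)) rest))
                     t≤u ↭-refl (trans q (shift u vs us)))
    where
    c′ : Components E G Y (C ∷ Ds ++ Cs)
    c′ = components-↭ c (shift C Ds Cs)

  psi-apart : ∀ {C Cs t ts Z} → All (Disjoint C) Cs → IsC C t → PWC Cs ts →
    InPsi Z t → Any (InPsi Z) ts → ⊥
  psi-apart (d ∷ ds) ct (r ∷ rs) ip (here ip′) with psi-nonempty ct ip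
  ... | z , z∈Z = ⊥-elim (d (z , x∈p∩q⁺ (psi-⊆ ct ip z∈Z , psi-⊆ r ip′ z∈Z)))
  psi-apart (d ∷ ds) ct (r ∷ rs) ip (there ips) = psi-apart ds ct rs ip ips

  psi-restrict : ∀ {Cs ts us} → AllPairs Disjoint Cs → PWC Cs ts → PWC Cs us →
    (∀ Z → Any (InPsi Z) us → Any (InPsi Z) ts) →
    Pointwise₃ (λ C t u → IsC C t × IsC C u × u ⊆ψ t) Cs ts us
  psi-restrict [] [] [] incl = []
  psi-restrict {C ∷ Cs} {t ∷ ts} {u ∷ us} (d ∷ ds) (ct ∷ cts) (cu ∷ cus) incl =
    (ct , cu , head) ∷ psi-restrict ds cts cus tail
    where
    head : u ⊆ψ t
    head Z ip with incl Z (here ip)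
    ... | here ip′ = ip′
    ... | there ips = ⊥-elim (psi-apart d cu cts ip ips)
    tail : ∀ Z → Any (InPsi Z) us → Any (InPsi Z) ts
    tail Z ips with incl Z (there ips)
    ... | here ip = ⊥-elim (psi-apart d ct cus ip ips)
    ... | there ips′ = ips′

  psi-children : ∀ {G Y Ds ts us} → G ⊆ H → IsC G (node Y ts) → Nonempty Y → Y ⊆ G →
    Components E G Y Ds → PWC Ds us → node Y us ⊆ψ node Y ts →
    ∀ Z → Any (InPsi Z) us → Any (InPsi Z) ts
  psi-children G⊆H cS neY Y⊆G cD pwD incl Z ips with find ips
  ... | u , u∈ , ip with Pointwise-∈ˡ pwD u∈
  ... | D , D∈ , cu with incl Z (there u∈ ip)
  ... | here eq = ⊥-elim (⊆-─-≢ neY Y⊆G (λ m → comp-⊆ cD D∈ (psi-⊆ cu ip m)) (≡-trans eq (up-≡ G⊆H cS)))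
  ... | there t∈ ip′ = lose t∈ ip′

  Complete : Tree n → Set
  Complete S = ∀ {G T} → G ⊆ H → IsC G S → IsC G T → T ⊆ψ S → Le E G S T

  complete-same-root : ∀ {G Y ts us} → (∀ {t} → t ∈ᴸ ts → Complete t) → G ⊆ H →
    IsC G (node Y ts) → IsC G (node Y us) → node Y us ⊆ψ node Y ts → Le E G (node Y ts) (node Y us)
  complete-same-root _ _ (leaf _ _) (leaf _ _) _ = le-refl
  complete-same-root _ _ (leaf _ refl) (step _ (_ , z , z∈G , z∉G) _ _) _ = ⊥-elim (z∉G z∈G)
  complete-same-root _ _ (step _ (_ , z , z∈G , z∉G) _ _) (leaf _ refl) _ = ⊥-elim (z∉G z∈G)
  complete-same-root {G} {Y} {ts} {us} complete-children G⊆H cS@(step {Cs = Cs} neY Y⊂G cC pwC)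
                     (step _ _ cD pwD) incl
    with Pointwise-↭ (components-unique G⊆H cC cD) pwD
  ... | us′ , pwU′ , us′↭us = le-children neY Y⊂G cC [] (Pointwise₃-map compare restricted) ↭-refl (↭-sym us′↭us)
    where
    restricted : Pointwise₃ (λ C t u → IsC C t × IsC C u × u ⊆ψ t) Cs ts us′
    restricted = psi-restrict (comp-disjoint cC) pwC pwU′
      (λ Z ips → psi-children G⊆H cS neY (proj₁ Y⊂G) cD pwD incl Z (Any-resp-↭ us′↭us ips))
    compare : ∀ {C t u} → C ∈ᴸ Cs → t ∈ᴸ ts → IsC C t × IsC C u × u ⊆ψ t → Refines C t u
    compare C∈ t∈ (ct , cu , u⊆ψt) = ct , cu , complete-children t∈ (comp-⊆H cC G⊆H C∈) ct cu u⊆ψt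

  complete-by-merge : ∀ {k G Y ts Y′ us x} → (∀ S′ → size S′ ≤ k → Complete S′) →
    size (node Y ts) ≤ suc k → G ⊆ H → IsC G (node Y ts) → IsC G (node Y′ us) →
    node Y′ us ⊆ψ node Y ts → x ∈ Y′ → x ∉ Y → Le E G (node Y ts) (node Y′ us)
  complete-by-merge below sz G⊆H (leaf _ refl) cT incl x∈Y′ x∉Y = ⊥-elim (x∉Y (label-⊆ cT x∈Y′))
  complete-by-merge {k} {G} {Y} {ts} {Y′} {us} below sz G⊆H (step neY Y⊂G c pw) cT incl x∈Y′ x∉Y
    with pick pw (comp-complete c G⊆H (x∈p∧x∉q⇒x∈p─q (label-⊆ cT x∈Y′) x∉Y))
  ... | picked {a = C} {as′ = Cs′} {bs′ = ts′} Cs↭ ts↭ ct pw′ x∈C with unfold ct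
  ... | unfolded {X = X} {t₁s = t₁s} refl neX X⊆C cX pwH =
    le-trans (le-merge neY Y⊂G c′ neX X⊆C cX pwH pw′ ts↭ ↭-refl)
             (below S′ smaller G⊆H merged cT incl′)
    where
    S′ : Tree n
    S′ = node (Y ∪ X) (t₁s ++ ts′)
    c′ : Components E G Y (C ∷ Cs′)
    c′ = components-↭ c Cs↭
    C⊆H : C ⊆ H
    C⊆H = comp-⊆H c′ G⊆H (here refl)
    merged : IsC G S′
    merged = construct (proj₁ neY , x∈p∪q⁺ (inj₁ (proj₂ neY)))
                       (∪-⊆ (proj₁ Y⊂G) (λ m → proj₁ (x∈p─q⁻ (comp-⊆ c′ (here refl) (X⊆C m)))))
                       (components-merge G⊆H c′ X⊆C cX) (Pointwise.++⁺ pwH pw′)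
    smaller : size S′ ≤ k
    smaller = subst (_≤ k) (size-merge ts↭) (s≤s⁻¹ sz)
    incl′ : node Y′ us ⊆ψ S′
    incl′ Z i with psi-merge⁻ ts↭ ↭-refl (incl Z i)
    ... | inj₂ i′ = i′
    ... | inj₁ Z≡C = ⊥-elim (component-∉ψ G⊆H neY (proj₁ Y⊂G) (comp-⊆ c′ (here refl)) cT x∈C x∈Y′
                       (subst (λ W → InPsi W (node Y′ us)) (≡-trans Z≡C (up-≡ C⊆H ct)) i))

  complete : ∀ k S → size S ≤ k → Complete S
  complete zero (node _ _) ()
  complete (suc k) (node Y ts) sz {G} {node Y′ us} G⊆H cS cT incl with nonempty? (Y′ ─ Y)
  ... | yes (x , x∈Y′─Y) = complete-by-merge (complete k) sz G⊆H cS cT incl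
                             (proj₁ (x∈p─q⁻ x∈Y′─Y)) (proj₂ (x∈p─q⁻ x∈Y′─Y))
  ... | no Y′⊆Y with ⊆-antisym (root-⊆ G⊆H cS cT incl) (empty-─⇒⊆ Y′⊆Y)
  ...   | refl = complete-same-root (λ t∈ → complete k _ (≤-trans (size-∈ t∈) (s≤s⁻¹ sz))) G⊆H cS cT incl

-- The converse uses only the absence of an empty edge and atomicity; the
-- connectivity that matters is that of the components, not of H itself.
lemma5 : ∀ {n} (E : Edges n) (H : Subset n) →
    IsHypergraphOn E H → Atomic E H → Connected E H →
    ∀ S T → IsConstruct E H S → IsConstruct E H T →
    (Le E H S T → T ⊆ψ S) × (T ⊆ψ S → Le E H S T)
lemma5 E H hyp atomic _ S T cS cT =
  le-psi , Converse.complete E H (proj₁ hyp) atomic (size S) S ≤-refl ⊆-refl cS cT
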